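{- For integers $n\ge 1$ let $f(n)=\#\{k : 1\le k\le n,\ k\equiv n \pmod{2^k}\}$. For each integer $m\ge 1$ let $g(m)$ be the smallest $n\ge 1$ with $f(n)=m$. Then $g(1)=1$ and $g(m+1)=2^{g(m)}+g(m)$ for all $m\ge 1$ (so $g(m)$ is defined for every $m\ge1$, with values $1,3,11,2059,2^{2059}+2059,\dots$). -}

module Defs where

open import Data.Nat using (ℕ; zero; suc; _+_; _∸_; _^_; _≤_; _<_)
open import Data.Nat.Divisibility using (_∣_; _∣?_)
open import Data.List using (List; length; filter)
open import Data.List.Base using (upTo)
open import Data.Product using (_×_)
open import Relation.Binary.PropositionalEquality using (_≡_)

range1 : ℕ → List ℕ
range1 n = Data.List.map suc (upTo n)

-- For 1 ≤ k ≤ n, "k ≡ n (mod 2^k)" is exactly 2^k ∣ (n - k), with n ∸ k = n - k.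
f : ℕ → ℕ
f n = length (filter (λ k → (2 ^ k) ∣? (n ∸ k)) (range1 n))

IsLeastWithF : ℕ → ℕ → Set
IsLeastWithF m n = (1 ≤ n) × (f n ≡ m) × (∀ n′ → 1 ≤ n′ → f n′ ≡ m → n ≤ n′)

-- the claimed values: G 1 = 1, G (m+1) = 2^(G m) + G m  (G 0 is an unused dummy)
G : ℕ → ℕ
G zero = 0
G (suc zero) = 1
G (suc (suc m)) = 2 ^ G (suc m) + G (suc m)

{-# OPTIONS --safe #-}
module Submission where

-- Call k a hit of n when 1 ≤ k ≤ n and 2^k ∣ n − k, so that f n counts the hits of n.
-- If k < k′ are both hits of n then 2^k divides (n − k) − (n − k′) = k′ − k > 0,
-- hence k′ ≥ 2^k + k: consecutive hits are at least as far apart as consecutive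
-- values of G, and the i-th hit of n is ≥ G i, so G (f n) ≤ n. Conversely G 1, …, G m
-- are all hits of G m, because G m − G i is a sum of powers 2^(G j) with j ≥ i.

open import Defs
open import Data.Nat using (ℕ; zero; suc; _+_; _∸_; _^_; _≤_; _<_; _≤′_; ≤′-refl; ≤′-step; s≤s; z≤n; >-nonZero)
open import Data.Nat.Properties
open import Data.Nat.Divisibility using (_∣_; _∣?_; ∣-trans; ∣-refl; n∣m*n; ∣⇒≤; _∣0; 1∣_; ∣m∣n⇒∣m+n; ∣m+n∣m⇒∣n)
open import Data.List using (length; filter; map; _++_; [_])
open import Data.List.Base using (upTo)
open import Data.List.Properties using (upTo-∷ʳ; map-++; filter-++; length-++; filter-accept; filter-reject)
open import Data.Product using (Σ-syntax; _×_; _,_)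
open import Data.Sum using (inj₁; inj₂)
open import Relation.Nullary using (¬_; yes; no)
open import Relation.Unary using (Decidable)
open import Relation.Binary.PropositionalEquality using (_≡_; refl; sym; trans; cong; subst)

range1-suc : ∀ j → range1 (suc j) ≡ range1 j ++ [ suc j ]
range1-suc j = trans (cong (map suc) (sym (upTo-∷ʳ j))) (map-++ suc (upTo j) [ j ])

module Counting {P : ℕ → Set} (P? : Decidable P) where

  count : ℕ → ℕ
  count j = length (filter P? (range1 j))

  count-suc : ∀ j → count (suc j) ≡ count j + length (filter P? [ suc j ])
  count-suc j = trans (cong (λ xs → length (filter P? xs)) (range1-suc j))
    (trans (cong length (filter-++ P? (range1 j) [ suc j ])) (length-++ (filter P? (range1 j))))

  count-hit : ∀ {j} → P (suc j) → count (suc j) ≡ suc (count j)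
  count-hit {j} p = trans (count-suc j)
    (trans (cong (λ xs → count j + length xs) (filter-accept P? p)) (+-comm (count j) 1))

  count-miss : ∀ {j} → ¬ P (suc j) → count (suc j) ≡ count j
  count-miss {j} ¬p = trans (count-suc j)
    (trans (cong (λ xs → count j + length xs) (filter-reject P? ¬p)) (+-identityʳ (count j)))

  count-≤-suc : ∀ j → count j ≤ count (suc j)
  count-≤-suc j with P? (suc j)
  ... | yes p = ≤-trans (n≤1+n (count j)) (≤-reflexive (sym (count-hit p)))
  ... | no ¬p = ≤-reflexive (sym (count-miss ¬p))

  count-mono : ∀ {j j′} → j ≤ j′ → count j ≤ count j′
  count-mono j≤j′ = go (≤⇒≤′ j≤j′)
    where
    go : ∀ {j j′} → j ≤′ j′ → count j ≤ count j′
    go ≤′-refl = ≤-refl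
    go (≤′-step p) = ≤-trans (go p) (count-≤-suc _)

  count-hit-above : ∀ {j j′} → j < j′ → P j′ → suc (count j) ≤ count j′
  count-hit-above {j} {suc j′} (s≤s j≤j′) p =
    ≤-trans (s≤s (count-mono j≤j′)) (≤-reflexive (sym (count-hit p)))

  count-lower : (e : ℕ → ℕ) → (∀ i → e i < e (suc i)) →
                ∀ m → (∀ {i} → i < m → P (e (suc i))) → m ≤ count (e m)
  count-lower e e-< zero hits = z≤n
  count-lower e e-< (suc m) hits =
    ≤-trans (s≤s (count-lower e e-< m (λ i<m → hits (m<n⇒m<1+n i<m))))
            (count-hit-above (e-< m) (hits (n<1+n m)))

  -- 0 acts as a sentinel hit below all genuine ones, which start at 1.
  module _ (e : ℕ → ℕ) (e0≡0 : e 0 ≡ 0) (P0 : P 0) (N : ℕ)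
           (e-gap : ∀ i {k k′} → k < k′ → k′ ≤ N → P k → P k′ → e i ≤ k → e (suc i) ≤ k′) where

    last-hit-bound : ∀ j → j ≤ N → Σ[ k ∈ ℕ ] k ≤ j × P k × e (count j) ≤ k
    last-hit-bound zero _ = 0 , z≤n , P0 , ≤-reflexive e0≡0
    last-hit-bound (suc j) j<N with last-hit-bound j (<⇒≤ j<N) | P? (suc j)
    ... | k , k≤j , pk , ek | yes p =
      suc j , ≤-refl , p , subst (λ c → e c ≤ suc j) (sym (count-hit p)) (e-gap (count j) (s≤s k≤j) j<N pk p ek)
    ... | k , k≤j , pk , ek | no ¬p =
      k , m≤n⇒m≤1+n k≤j , pk , subst (λ c → e c ≤ k) (sym (count-miss ¬p)) ek

    count-upper : e (count N) ≤ N
    count-upper with last-hit-bound N ≤-refl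
    ... | k , k≤N , _ , ek = ≤-trans ek k≤N

^-monoʳ-∣ : ∀ m {a b} → a ≤ b → m ^ a ∣ m ^ b
^-monoʳ-∣ m a≤b = go (≤⇒≤′ a≤b)
  where
  go : ∀ {a b} → a ≤′ b → m ^ a ∣ m ^ b
  go ≤′-refl = ∣-refl
  go (≤′-step p) = ∣-trans (go p) (n∣m*n m)

Hit : ℕ → ℕ → Set
Hit n k = 2 ^ k ∣ n ∸ k

hit? : ∀ n → Decidable (Hit n)
hit? n k = 2 ^ k ∣? n ∸ k

hit-gap : ∀ {n k k′} → k < k′ → k′ ≤ n → Hit n k → Hit n k′ → 2 ^ k + k ≤ k′
hit-gap {n} {k} {k′} k<k′ k′≤n hk hk′ = begin
    2 ^ k + k        ≤⟨ +-monoˡ-≤ k 2^k≤k′∸k ⟩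
    (k′ ∸ k) + k     ≡⟨ m∸n+n≡m (<⇒≤ k<k′) ⟩
    k′               ∎
  where
  open ≤-Reasoning
  n∸k-split : n ∸ k ≡ (n ∸ k′) + (k′ ∸ k)
  n∸k-split = trans (cong (_∸ k) (sym (m∸n+n≡m k′≤n))) (+-∸-assoc (n ∸ k′) (<⇒≤ k<k′))
  2^k∣k′∸k : 2 ^ k ∣ k′ ∸ k
  2^k∣k′∸k = ∣m+n∣m⇒∣n (subst (2 ^ k ∣_) n∸k-split hk) (∣-trans (^-monoʳ-∣ 2 (<⇒≤ k<k′)) hk′)
  2^k≤k′∸k : 2 ^ k ≤ k′ ∸ k
  2^k≤k′∸k = ∣⇒≤ {{>-nonZero (m<n⇒0<n∸m k<k′)}} 2^k∣k′∸k

leap : ℕ → ℕ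
leap x = 2 ^ x + x

leap-mono : ∀ {a b} → a ≤ b → leap a ≤ leap b
leap-mono a≤b = +-mono-≤ (^-monoʳ-≤ 2 a≤b) a≤b

G-suc : ∀ i → G (suc i) ≡ leap (G i)
G-suc zero = refl
G-suc (suc i) = refl

G-<-suc : ∀ i → G i < G (suc i)
G-<-suc i = subst (G i <_) (sym (G-suc i)) (m<n+m (G i) (m^n>0 2 (G i)))

G-strictMono : ∀ {a b} → a < b → G a < G b
G-strictMono a<b = go (≤⇒≤′ a<b)
  where
  go : ∀ {a b} → suc a ≤′ b → G a < G b
  go {a} ≤′-refl = G-<-suc a
  go (≤′-step {b} p) = <-trans (go p) (G-<-suc b)

G-mono : ∀ {a b} → a ≤ b → G a ≤ G b
G-mono a≤b with m≤n⇒m<n∨m≡n a≤b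
... | inj₁ a<b = <⇒≤ (G-strictMono a<b)
... | inj₂ refl = ≤-refl

G-cancel-≤ : ∀ {a b} → G a ≤ G b → a ≤ b
G-cancel-≤ Ga≤Gb = ≮⇒≥ (λ b<a → <⇒≱ (G-strictMono b<a) Ga≤Gb)

G-hit : ∀ {i m} → i ≤ m → Hit (G m) (G i)
G-hit i≤m = go (≤⇒≤′ i≤m)
  where
  go : ∀ {i m} → i ≤′ m → 2 ^ G i ∣ G m ∸ G i
  go {i} ≤′-refl = subst (2 ^ G i ∣_) (sym (n∸n≡0 (G i))) ((2 ^ G i) ∣0)
  go {i} (≤′-step {m} p) = subst (2 ^ G i ∣_) G[1+m]∸Gi
      (∣m∣n⇒∣m+n (^-monoʳ-∣ 2 Gi≤Gm) (go p))
    where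
    Gi≤Gm : G i ≤ G m
    Gi≤Gm = G-mono (≤′⇒≤ p)
    G[1+m]∸Gi : 2 ^ G m + (G m ∸ G i) ≡ G (suc m) ∸ G i
    G[1+m]∸Gi = trans (sym (+-∸-assoc (2 ^ G m) Gi≤Gm)) (cong (_∸ G i) (sym (G-suc m)))

f-G-lower : ∀ m → m ≤ f (G m)
f-G-lower m = Counting.count-lower (hit? (G m)) G G-<-suc m (λ i<m → G-hit i<m)

G-f-upper : ∀ n → G (f n) ≤ n
G-f-upper n = Counting.count-upper (hit? n) G refl (1∣ n) n G-gap
  where
  G-gap : ∀ i {k k′} → k < k′ → k′ ≤ n → Hit n k → Hit n k′ → G i ≤ k → G (suc i) ≤ k′
  G-gap i {k′ = k′} k<k′ k′≤n hk hk′ Gi≤k = subst (_≤ k′) (sym (G-suc i))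
    (≤-trans (leap-mono Gi≤k) (hit-gap k<k′ k′≤n hk hk′))

mainTheorem7 : ∀ (m : ℕ) → 1 ≤ m → IsLeastWithF m (G m)
mainTheorem7 m 1≤m = G-mono 1≤m , f[Gm]≡m , minimal
  where
  f[Gm]≡m : f (G m) ≡ m
  f[Gm]≡m = ≤-antisym (G-cancel-≤ (G-f-upper (G m))) (f-G-lower m)
  minimal : ∀ n′ → 1 ≤ n′ → f n′ ≡ m → G m ≤ n′
  minimal n′ _ refl = G-f-upper n′
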